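{- For any connected graphs $G$ and $H$, $$\dim_s(G\Box H)\le\min\{\dim_s(G)\,|\partial(H)|,\ |\partial(G)|\,\dim_s(H)\}.$$
   Context: All graphs are finite and simple. For a connected graph $G$, $d_G$ is the shortest-path distance and $I_G[u,v]$ is the set of vertices on some shortest $u$–$v$ path. A vertex $w$ strongly resolves $u,v$ if $v\in I_G[u,w]$ or $u\in I_G[v,w]$. A strong resolving set is a set $S\subseteq V(G)$ such that every pair of vertices is strongly resolved by some vertex of $S$; $\dim_s(G)$ is the minimum size of one. A vertex $u$ is maximally distant from $v$ if $d_G(v,w)\le d_G(u,v)$ for every neighbor $w$ of $u$; $u,v$ are mutually maximally distant if each is maximally distant from the other. The boundary $\partial(G)$ is the set of vertices $u$ for which some $v$ exists with $u,v$ mutually maximally distant. $G\Box H$ is the Cartesian product: vertex set $V(G)\times V(H)$, $(a,b)\sim(c,d)$ iff ($a=c$ and $bd\in E(H)$) or ($b=d$ and $ac\in E(G)$). -}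

module Defs where

open import Data.Nat using (ℕ; zero; suc; _+_; _*_; _≤_)
open import Data.Bool using (Bool; true; false; T; _∧_; _∨_)
open import Data.Fin using (Fin; remQuot)
open import Data.Fin.Subset using (Subset; _∈_; ∣_∣)
open import Data.Product using (Σ; ∃; ∃-syntax; _×_; _,_; proj₁; proj₂)
open import Data.Sum using (_⊎_)
open import Relation.Nullary using (¬_; does)
open import Relation.Binary.PropositionalEquality using (_≡_)
import Data.Fin as F

record Graph : Set where
  constructor mkGraph
  field
    n      : ℕ
    adj    : Fin n → Fin n → Bool

open Graph public

Simple : Graph → Set
Simple G = (∀ u v → adj G u v ≡ adj G v u) × (∀ u → adj G u u ≡ false)

Vtx : Graph → Set
Vtx G = Fin (n G)

Adj : (G : Graph) → Vtx G → Vtx G → Set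
Adj G u v = T (adj G u v)

data Walk (G : Graph) : Vtx G → Vtx G → ℕ → Set where
  stay : ∀ u → Walk G u u zero
  step : ∀ {u w v k} → Adj G u w → Walk G w v k → Walk G u v (suc k)

Connected : Graph → Set
Connected G = ∀ u v → ∃[ k ] Walk G u v k

Dist : (G : Graph) → Vtx G → Vtx G → ℕ → Set
Dist G u v k = Walk G u v k × (∀ m → Walk G u v m → k ≤ m)

-- w ∈ I_G[u,v] : w lies on some shortest u–v path, i.e. there is a u–w walk
-- and a w–v walk whose lengths add up to d_G(u,v).
InInterval : (G : Graph) → Vtx G → Vtx G → Vtx G → Set
InInterval G w u v =
  ∃[ a ] ∃[ b ] ∃[ d ] (Walk G u w a × Walk G w v b × Dist G u v d × a + b ≡ d)

StronglyResolves : (G : Graph) → Vtx G → Vtx G → Vtx G → Set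
StronglyResolves G w u v = InInterval G v u w ⊎ InInterval G u v w

IsStrongResolvingSet : (G : Graph) → Subset (n G) → Set
IsStrongResolvingSet G S =
  ∀ u v → ∃[ w ] (w ∈ S × StronglyResolves G w u v)

IsStrongMetricDim : (G : Graph) → ℕ → Set
IsStrongMetricDim G k =
  (∃[ S ] (IsStrongResolvingSet G S × ∣ S ∣ ≡ k))
  × (∀ S → IsStrongResolvingSet G S → k ≤ ∣ S ∣)

MaximallyDistant : (G : Graph) → Vtx G → Vtx G → Set
MaximallyDistant G u v =
  ∀ w a b → Adj G u w → Dist G v w a → Dist G u v b → a ≤ b

MutuallyMaximallyDistant : (G : Graph) → Vtx G → Vtx G → Set
MutuallyMaximallyDistant G u v = MaximallyDistant G u v × MaximallyDistant G v u

InBoundary : (G : Graph) → Vtx G → Set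
InBoundary G u = ∃[ v ] MutuallyMaximallyDistant G u v

IsBoundary : (G : Graph) → Subset (n G) → Set
IsBoundary G B = ∀ u → (u ∈ B → InBoundary G u) × (InBoundary G u → u ∈ B)

-- Cartesian product G □ H on Fin (n G * n H), vertex i ↔ remQuot i = (g , h).
□-adj : (G H : Graph) → Fin (n G * n H) → Fin (n G * n H) → Bool
□-adj G H i j with remQuot {n G} (n H) i | remQuot {n G} (n H) j
... | (a , b) | (c , d) =
  (does (a F.≟ c) ∧ adj H b d) ∨ (does (b F.≟ d) ∧ adj G a c)

_□_ : Graph → Graph → Graph
G □ H = mkGraph (n G * n H) (□-adj G H)

-- Distances in G □ H add up coordinatewise, so a product vertex (x , y) strongly
-- resolves (a , b), (c , d) as soon as c lies on an a–x geodesic and d on a b–y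
-- geodesic (or both with the roles of the two pairs exchanged).  A strong resolving
-- set S of G supplies such an x for every pair a, c, and the boundary of H supplies
-- such a y with the orientation prescribed by x: for any h, h′ there is a boundary
-- vertex b with h′ on an h–b geodesic.  Hence S × ∂(H) strongly resolves G □ H, and
-- symmetrically ∂(G) × T for a strong resolving set T of H.
--
-- The boundary vertex b is found by two maximisations: b maximises d(h, ·) among
-- the vertices z with h′ on an h–z geodesic, which makes b a local maximum of
-- d(h, ·); then v maximises d(b, ·) among the z with h on a b–z geodesic.  Since h
-- lies on a b–v geodesic, b is also a local maximum of d(v, ·), so b and v are
-- mutually maximally distant.
module Submission where

open import Defs
open import Data.Nat using (ℕ; _≤_; _*_; _⊓_)
open import Data.Fin.Subset using (Subset; ∣_∣)

open import Data.Nat using (zero; suc; _+_; _<_; _≤?_; _<?_)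
import Data.Nat as ℕ
open import Data.Nat.Properties
open import Algebra.Properties.CommutativeSemigroup +-commutativeSemigroup using (interchange)
open import Data.Fin using (remQuot; combine; _↑ˡ_; _↑ʳ_)
import Data.Fin as Fin
open import Data.Fin.Properties using (any?; remQuot-combine; combine-remQuot)
open import Data.Fin.Subset using (_∈_; ⊥)
open import Data.Fin.Subset.Properties using (∣⊥∣≡0)
open import Data.Bool using (true; false; T; T?; if_then_else_)
open import Data.Bool.Properties using (T-∧; T-∨)
open import Data.Product using (∃-syntax; _×_; _,_; proj₁; proj₂)
open import Data.Product.Function.NonDependent.Propositional using (_×-⇔_)
open import Data.Sum using (_⊎_; inj₁; inj₂)
open import Data.Sum.Function.Propositional using (_⊎-⇔_)
open import Data.List using (List; filter; upTo; allFin)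
open import Data.List.Extrema ≤-totalOrder
  using (min; min≤⊤; min≤v⁺; argmin-all; argmax; argmax-all; f[xs]≤f[argmax])
open import Data.List.Membership.Propositional using (lose)
open import Data.List.Membership.Propositional.Properties using (∈-filter⁺; ∈-upTo⁺; ∈-allFin)
open import Data.List.Relation.Unary.All using (lookup)
open import Data.List.Relation.Unary.All.Properties using (all-filter)
open import Data.Vec using ([]; _∷_; _++_; here; there)
open import Data.Vec.Properties using (lookup⇒[]=; []=⇒lookup; lookup-++ˡ; lookup-++ʳ)
open import Function.Bundles using (_⇔_; mk⇔; Equivalence)
open import Function.Base using (id)
open import Function.Properties.Equivalence using () renaming (refl to ⇔-refl; trans to ⇔-trans)
open import Relation.Nullary using (Dec; yes; no; does; contradiction)
open import Relation.Nullary.Decidable using (map′; _×-dec_)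
open import Relation.Unary using (Decidable)
open import Relation.Binary.PropositionalEquality

least-witness : {P : ℕ → Set} → Decidable P → ∀ {k} → P k →
                ∃[ m ] (P m × (∀ {j} → P j → m ≤ j))
least-witness {P} P? {k} pk = min k candidates , argmin-all id pk (all-filter P? (upTo k)) , least
  where
  candidates : List ℕ
  candidates = filter P? (upTo k)

  least : ∀ {j} → P j → min k candidates ≤ j
  least {j} pj with j <? k
  ... | yes j<k = min≤v⁺ k candidates (inj₂ (lose (∈-filter⁺ P? (∈-upTo⁺ j<k) pj) ≤-refl))
  ... | no j≮k  = ≤-trans (min≤⊤ k candidates) (≮⇒≥ j≮k)

T-does : {P : Set} (P? : Dec P) → T (does P?) ⇔ P
T-does (yes p) = mk⇔ (λ _ → p) (λ _ → _)
T-does (no ¬p) = mk⇔ (λ ()) ¬p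

module _ {G : Graph} where

  _++ʷ_ : ∀ {u w v a b} → Walk G u w a → Walk G w v b → Walk G u v (a + b)
  stay _   ++ʷ q = q
  step e p ++ʷ q = step e (p ++ʷ q)

  walk? : ∀ k u v → Dec (Walk G u v k)
  walk? zero u v with u Fin.≟ v
  ... | yes refl = yes (stay u)
  ... | no u≢v   = no λ { (stay _) → u≢v refl }
  walk? (suc k) u v =
    map′ (λ (_ , e , p) → step e p) (λ { (step e p) → _ , e , p })
      (any? λ w → T? (adj G u w) ×-dec walk? k w v)

module Metric (G : Graph) (adj-sym : ∀ u v → adj G u v ≡ adj G v u)
              (connected : Connected G) where

  Adj-sym : ∀ {u v} → Adj G u v → Adj G v u
  Adj-sym {u} {v} = subst T (adj-sym u v)

  reverse : ∀ {u v k} → Walk G u v k → Walk G v u k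
  reverse (stay u)            = stay u
  reverse (step {k = k} e p) =
    subst (Walk G _ _) (+-comm k 1) (reverse p ++ʷ step (Adj-sym e) (stay _))

  -- Abstract, since unfolding dist would make the type checker run the walk search.
  abstract
    shortest : ∀ u v → ∃[ m ] (Walk G u v m × (∀ {j} → Walk G u v j → m ≤ j))
    shortest u v = least-witness (λ k → walk? k u v) (proj₂ (connected u v))

  dist : Vtx G → Vtx G → ℕ
  dist u v = proj₁ (shortest u v)

  dist-walk : ∀ u v → Walk G u v (dist u v)
  dist-walk u v = proj₁ (proj₂ (shortest u v))

  dist-minimal : ∀ {u v k} → Walk G u v k → dist u v ≤ k
  dist-minimal {u} {v} = proj₂ (proj₂ (shortest u v))

  Dist⇒≡dist : ∀ {u v k} → Dist G u v k → k ≡ dist u v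
  Dist⇒≡dist {u} {v} (p , minimal) = ≤-antisym (minimal _ (dist-walk u v)) (dist-minimal p)

  dist-sym : ∀ u v → dist u v ≡ dist v u
  dist-sym u v = ≤-antisym (dist-minimal (reverse (dist-walk v u)))
                           (dist-minimal (reverse (dist-walk u v)))

  dist-refl : ∀ u → dist u u ≡ 0
  dist-refl u = n≤0⇒n≡0 (dist-minimal (stay u))

  dist-triangle : ∀ u w v → dist u v ≤ dist u w + dist w v
  dist-triangle u w v = dist-minimal (dist-walk u w ++ʷ dist-walk w v)

  dist-step : ∀ u {v w} → Adj G v w → dist u w ≤ suc (dist u v)
  dist-step u {v} e = dist-minimal (reverse (step (Adj-sym e) (reverse (dist-walk u v))))

  Between : Vtx G → Vtx G → Vtx G → Set
  Between x y z = dist x y + dist y z ≡ dist x z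

  Between? : ∀ x y z → Dec (Between x y z)
  Between? x y z = dist x y + dist y z ℕ.≟ dist x z

  Between-refl : ∀ x y → Between x y y
  Between-refl x y = trans (cong (dist x y +_) (dist-refl y)) (+-identityʳ _)

  InInterval⇒Between : ∀ {x y z} → InInterval G y x z → Between x y z
  InInterval⇒Between {x} {y} {z} (_ , _ , _ , p , q , D , a+b≡d) =
    ≤-antisym (≤-trans (+-mono-≤ (dist-minimal p) (dist-minimal q))
                       (≤-reflexive (trans a+b≡d (Dist⇒≡dist D))))
              (dist-triangle x y z)

  LocallyFarthest : Vtx G → Vtx G → Set
  LocallyFarthest x z = ∀ {w} → Adj G z w → dist x w ≤ dist x z

  LocallyFarthest⇒MaximallyDistant : ∀ {x z} → LocallyFarthest x z → MaximallyDistant G z x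
  LocallyFarthest⇒MaximallyDistant {x} {z} far w _ _ e Dxw Dzx =
    subst₂ _≤_ (sym (Dist⇒≡dist Dxw)) (trans (dist-sym x z) (sym (Dist⇒≡dist Dzx))) (far e)

  Between-step : ∀ {x y z w} → Between x y z → Adj G z w → dist x z < dist x w → Between x y w
  Between-step {x} {y} {z} {w} y∈[x,z] e further = ≤-antisym extend (dist-triangle x y w)
    where
    open ≤-Reasoning
    extend : dist x y + dist y w ≤ dist x w
    extend = begin
      dist x y + dist y w        ≤⟨ +-monoʳ-≤ (dist x y) (dist-step y e) ⟩
      dist x y + suc (dist y z)  ≡⟨ +-suc (dist x y) (dist y z) ⟩
      suc (dist x y + dist y z)  ≡⟨ cong suc y∈[x,z] ⟩
      suc (dist x z)             ≤⟨ further ⟩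
      dist x w                   ∎

  farthest-beyond : ∀ x y → ∃[ z ] (Between x y z × LocallyFarthest x z)
  farthest-beyond x y = z , y∈[x,z] , local
    where
    beyond : List (Vtx G)
    beyond = filter (Between? x y) (allFin (n G))

    z : Vtx G
    z = argmax (dist x) y beyond

    y∈[x,z] : Between x y z
    y∈[x,z] = argmax-all (dist x) (Between-refl x y) (all-filter (Between? x y) (allFin (n G)))

    local : LocallyFarthest x z
    local {w} e with dist x w ≤? dist x z
    ... | yes closer  = closer
    ... | no ¬closer = contradiction
      (lookup (f[xs]≤f[argmax] {f = dist x} y beyond)
              (∈-filter⁺ (Between? x y) (∈-allFin w) (Between-step y∈[x,z] e (≰⇒> ¬closer))))
      ¬closer

  LocallyFarthest-through : ∀ {x z v} → Between z x v → LocallyFarthest x z → LocallyFarthest v z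
  LocallyFarthest-through {x} {z} {v} x∈[z,v] far {w} e = begin
    dist v w             ≤⟨ dist-triangle v x w ⟩
    dist v x + dist x w  ≤⟨ +-monoʳ-≤ (dist v x) (far e) ⟩
    dist v x + dist x z  ≡⟨ cong₂ _+_ (dist-sym v x) (dist-sym x z) ⟩
    dist x v + dist z x  ≡⟨ +-comm (dist x v) (dist z x) ⟩
    dist z x + dist x v  ≡⟨ x∈[z,v] ⟩
    dist z v             ≡⟨ dist-sym z v ⟩
    dist v z             ∎
    where open ≤-Reasoning

  boundary-beyond : ∀ x y → ∃[ b ] (InBoundary G b × Between x y b)
  boundary-beyond x y =
    let b , y∈[x,b] , b-far = farthest-beyond x y
        v , x∈[b,v] , v-far = farthest-beyond b x
    in b , (v , LocallyFarthest⇒MaximallyDistant (LocallyFarthest-through x∈[b,v] b-far)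
              , LocallyFarthest⇒MaximallyDistant v-far)
         , y∈[x,b]

  Extending : Subset (n G) → Set
  Extending X = ∀ x y → ∃[ b ] (b ∈ X × Between x y b)

  IsBoundary⇒Extending : ∀ {B} → IsBoundary G B → Extending B
  IsBoundary⇒Extending ∂ x y =
    let b , b∈∂ , y∈[x,b] = boundary-beyond x y in b , proj₂ (∂ b) b∈∂ , y∈[x,b]

_×ˢ_ : ∀ {m k} → Subset m → Subset k → Subset (m * k)
[]      ×ˢ Y = []
(b ∷ X) ×ˢ Y = (if b then Y else ⊥) ++ (X ×ˢ Y)

∣++∣ : ∀ {k m} (Y : Subset k) (Z : Subset m) → ∣ Y ++ Z ∣ ≡ ∣ Y ∣ + ∣ Z ∣
∣++∣ []          Z = refl
∣++∣ (true ∷ Y)  Z = cong suc (∣++∣ Y Z)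
∣++∣ (false ∷ Y) Z = ∣++∣ Y Z

∣×ˢ∣ : ∀ {m k} (X : Subset m) (Y : Subset k) → ∣ X ×ˢ Y ∣ ≡ ∣ X ∣ * ∣ Y ∣
∣×ˢ∣ []          Y = refl
∣×ˢ∣ (true ∷ X)  Y = trans (∣++∣ Y _) (cong (∣ Y ∣ +_) (∣×ˢ∣ X Y))
∣×ˢ∣ {k = k} (false ∷ X) Y =
  trans (∣++∣ (⊥ {n = k}) (X ×ˢ Y)) (cong₂ _+_ (∣⊥∣≡0 k) (∣×ˢ∣ X Y))

∈-++⁺ˡ : ∀ {k m} {Y : Subset k} {y} (Z : Subset m) → y ∈ Y → y ↑ˡ m ∈ Y ++ Z
∈-++⁺ˡ {Y = Y} {y} Z y∈Y = lookup⇒[]= _ _ (trans (lookup-++ˡ Y Z y) ([]=⇒lookup y∈Y))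

∈-++⁺ʳ : ∀ {k m} (Y : Subset k) {Z : Subset m} {z} → z ∈ Z → k ↑ʳ z ∈ Y ++ Z
∈-++⁺ʳ Y {Z} {z} z∈Z = lookup⇒[]= _ _ (trans (lookup-++ʳ Y Z z) ([]=⇒lookup z∈Z))

∈-×ˢ⁺ : ∀ {m k} {X : Subset m} {Y : Subset k} {x y} → x ∈ X → y ∈ Y → combine x y ∈ X ×ˢ Y
∈-×ˢ⁺ {X = true ∷ X} {Y} here        y∈Y = ∈-++⁺ˡ (X ×ˢ Y) y∈Y
∈-×ˢ⁺ {X = b ∷ X}    {Y} (there x∈X) y∈Y = ∈-++⁺ʳ (if b then Y else ⊥) (∈-×ˢ⁺ x∈X y∈Y)

module CartesianProduct (G H : Graph)
  (adj-symG : ∀ u v → adj G u v ≡ adj G v u) (adj-symH : ∀ u v → adj H u v ≡ adj H v u)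
  (connectedG : Connected G) (connectedH : Connected H) where

  open Metric G adj-symG connectedG using ()
    renaming (dist to distG; dist-walk to dist-walkG; dist-minimal to dist-minimalG;
              Between to BetweenG; InInterval⇒Between to InInterval⇒BetweenG;
              Extending to ExtendingG)
  open Metric H adj-symH connectedH using ()
    renaming (dist to distH; dist-walk to dist-walkH; dist-minimal to dist-minimalH;
              Between to BetweenH; InInterval⇒Between to InInterval⇒BetweenH;
              Extending to ExtendingH)

  π₁ : Vtx (G □ H) → Vtx G
  π₁ i = proj₁ (remQuot {n G} (n H) i)

  π₂ : Vtx (G □ H) → Vtx H
  π₂ i = proj₂ (remQuot {n G} (n H) i)

  data View : Vtx (G □ H) → Set where
    ⟨_,_⟩ : (a : Vtx G) (b : Vtx H) → View (combine a b)

  view : ∀ i → View i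
  view i = subst View (combine-remQuot {n G} (n H) i) ⟨ π₁ i , π₂ i ⟩

  Step : Vtx G × Vtx H → Vtx G × Vtx H → Set
  Step (a , b) (c , d) = (a ≡ c × Adj H b d) ⊎ (b ≡ d × Adj G a c)

  Adj-□ : ∀ i j → Adj (G □ H) i j ⇔ Step (remQuot {n G} (n H) i) (remQuot {n G} (n H) j)
  Adj-□ i j = ⇔-trans T-∨
    (⇔-trans T-∧ (T-does (π₁ i Fin.≟ π₁ j) ×-⇔ ⇔-refl) ⊎-⇔
     ⇔-trans T-∧ (T-does (π₂ i Fin.≟ π₂ j) ×-⇔ ⇔-refl))

  Adj-combine : ∀ {a b c d} → Step (a , b) (c , d) → Adj (G □ H) (combine a b) (combine c d)
  Adj-combine {a} {b} {c} {d} s = Equivalence.from (Adj-□ (combine a b) (combine c d))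
    (subst₂ Step (sym (remQuot-combine a b)) (sym (remQuot-combine c d)) s)

  liftG : ∀ {a c k} (b : Vtx H) → Walk G a c k → Walk (G □ H) (combine a b) (combine c b) k
  liftG b (stay a)   = stay _
  liftG b (step e p) = step (Adj-combine (inj₂ (refl , e))) (liftG b p)

  liftH : ∀ {b d k} (a : Vtx G) → Walk H b d k → Walk (G □ H) (combine a b) (combine a d) k
  liftH a (stay b)   = stay _
  liftH a (step e p) = step (Adj-combine (inj₁ (refl , e))) (liftH a p)

  project : ∀ {i j k} → Walk (G □ H) i j k →
    ∃[ k₁ ] ∃[ k₂ ] (Walk G (π₁ i) (π₁ j) k₁ × Walk H (π₂ i) (π₂ j) k₂ × k₁ + k₂ ≡ k)
  project (stay i) = 0 , 0 , stay _ , stay _ , refl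
  project (step {u = i} {w = w} e p)
    with k₁ , k₂ , p₁ , p₂ , k₁+k₂≡k ← project p
       | Equivalence.to (Adj-□ i w) e
  ... | inj₁ (same₁ , e₂) = k₁ , suc k₂ , subst (λ a → Walk G a _ k₁) (sym same₁) p₁ ,
                            step e₂ p₂ , trans (+-suc k₁ k₂) (cong suc k₁+k₂≡k)
  ... | inj₂ (same₂ , e₁) = suc k₁ , k₂ , step e₁ p₁ ,
                            subst (λ b → Walk H b _ k₂) (sym same₂) p₂ , cong suc k₁+k₂≡k

  Dist-□ : ∀ a b c d → Dist (G □ H) (combine a b) (combine c d) (distG a c + distH b d)
  Dist-□ a b c d = liftG b (dist-walkG a c) ++ʷ liftH c (dist-walkH b d) , minimal
    where
    minimal : ∀ k → Walk (G □ H) (combine a b) (combine c d) k → distG a c + distH b d ≤ k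
    minimal k p =
      let k₁ , k₂ , p₁ , p₂ , k₁+k₂≡k = project p
          pa = remQuot-combine a b
          pc = remQuot-combine c d
      in ≤-trans (+-mono-≤ (dist-minimalG (subst₂ (λ s t → Walk G (proj₁ s) (proj₁ t) k₁) pa pc p₁))
                           (dist-minimalH (subst₂ (λ s t → Walk H (proj₂ s) (proj₂ t) k₂) pa pc p₂)))
                 (≤-reflexive k₁+k₂≡k)

  InInterval-□ : ∀ {a b c d x y} → BetweenG a c x → BetweenH b d y →
                 InInterval (G □ H) (combine c d) (combine a b) (combine x y)
  InInterval-□ {a} {b} {c} {d} {x} {y} c∈[a,x] d∈[b,y] =
    _ , _ , _ , proj₁ (Dist-□ a b c d) , proj₁ (Dist-□ c d x y) , Dist-□ a b x y ,
    (begin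
      (distG a c + distH b d) + (distG c x + distH d y)
        ≡⟨ interchange (distG a c) (distH b d) (distG c x) (distH d y) ⟩
      (distG a c + distG c x) + (distH b d + distH d y)
        ≡⟨ cong₂ _+_ c∈[a,x] d∈[b,y] ⟩
      distG a x + distH b y ∎)
    where open ≡-Reasoning

  JointlyResolving : Subset (n G) → Subset (n H) → Set
  JointlyResolving X Y = ∀ a c b d → ∃[ x ] ∃[ y ] (x ∈ X × y ∈ Y ×
    ((BetweenG a c x × BetweenH b d y) ⊎ (BetweenG c a x × BetweenH d b y)))

  JointlyResolving⇒IsStrongResolvingSet : ∀ {X Y} → JointlyResolving X Y →
                                          IsStrongResolvingSet (G □ H) (X ×ˢ Y)
  JointlyResolving⇒IsStrongResolvingSet joint i j with view i | view j
  ... | ⟨ a , b ⟩ | ⟨ c , d ⟩ with joint a c b d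
  ... | x , y , x∈X , y∈Y , inj₁ (c∈[a,x] , d∈[b,y]) =
    combine x y , ∈-×ˢ⁺ x∈X y∈Y , inj₁ (InInterval-□ c∈[a,x] d∈[b,y])
  ... | x , y , x∈X , y∈Y , inj₂ (a∈[c,x] , b∈[d,y]) =
    combine x y , ∈-×ˢ⁺ x∈X y∈Y , inj₂ (InInterval-□ a∈[c,x] b∈[d,y])

  resolving×extending : ∀ {S B} → IsStrongResolvingSet G S → ExtendingH B → JointlyResolving S B
  resolving×extending resolving extending a c b d with resolving a c
  ... | s , s∈S , inj₁ c∈[a,s] with y , y∈B , d∈[b,y] ← extending b d =
    s , y , s∈S , y∈B , inj₁ (InInterval⇒BetweenG c∈[a,s] , d∈[b,y])
  ... | s , s∈S , inj₂ a∈[c,s] with y , y∈B , b∈[d,y] ← extending d b =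
    s , y , s∈S , y∈B , inj₂ (InInterval⇒BetweenG a∈[c,s] , b∈[d,y])

  extending×resolving : ∀ {B T} → ExtendingG B → IsStrongResolvingSet H T → JointlyResolving B T
  extending×resolving extending resolving a c b d with resolving b d
  ... | t , t∈T , inj₁ d∈[b,t] with x , x∈B , c∈[a,x] ← extending a c =
    x , t , x∈B , t∈T , inj₁ (c∈[a,x] , InInterval⇒BetweenH d∈[b,t])
  ... | t , t∈T , inj₂ b∈[d,t] with x , x∈B , a∈[c,x] ← extending c a =
    x , t , x∈B , t∈T , inj₂ (a∈[c,x] , InInterval⇒BetweenH b∈[d,t])

theorem24 : (G H : Graph) → Simple G → Simple H → Connected G → Connected H →
    (kG kH kGH : ℕ) → IsStrongMetricDim G kG → IsStrongMetricDim H kH →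
    IsStrongMetricDim (G □ H) kGH →
    (BG : Subset (n G)) → (BH : Subset (n H)) → IsBoundary G BG → IsBoundary H BH →
    kGH ≤ (kG * ∣ BH ∣) ⊓ (∣ BG ∣ * kH)
theorem24 G H (symG , _) (symH , _) cG cH kG kH kGH
          ((S , S-resolving , ∣S∣≡kG) , _) ((T , T-resolving , ∣T∣≡kH) , _) (_ , minimal)
          BG BH ∂G ∂H =
  ⊓-glb
    (begin
      kGH            ≤⟨ minimal (S ×ˢ BH) S×∂H-resolving ⟩
      ∣ S ×ˢ BH ∣    ≡⟨ ∣×ˢ∣ S BH ⟩
      ∣ S ∣ * ∣ BH ∣ ≡⟨ cong (_* ∣ BH ∣) ∣S∣≡kG ⟩
      kG * ∣ BH ∣    ∎)
    (begin
      kGH            ≤⟨ minimal (BG ×ˢ T) ∂G×T-resolving ⟩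
      ∣ BG ×ˢ T ∣    ≡⟨ ∣×ˢ∣ BG T ⟩
      ∣ BG ∣ * ∣ T ∣ ≡⟨ cong (∣ BG ∣ *_) ∣T∣≡kH ⟩
      ∣ BG ∣ * kH    ∎)
  where
  open CartesianProduct G H symG symH cG cH
  open ≤-Reasoning

  S×∂H-resolving : IsStrongResolvingSet (G □ H) (S ×ˢ BH)
  S×∂H-resolving = JointlyResolving⇒IsStrongResolvingSet
    (resolving×extending S-resolving (Metric.IsBoundary⇒Extending H symH cH ∂H))

  ∂G×T-resolving : IsStrongResolvingSet (G □ H) (BG ×ˢ T)
  ∂G×T-resolving = JointlyResolving⇒IsStrongResolvingSet
    (extending×resolving (Metric.IsBoundary⇒Extending G symG cG ∂G) T-resolving)
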